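{- Fix an integer $t\geq 2$. Let $L$ be a $t$-list-assignment of a graph $G$ such that for each vertex $v$ of $G$, $$4\sum_{w\in N_G(v)}|L(v)\cap L(w)|\;\leq\;t^2.$$ Then there exist at least $(\frac{t}{2})^{|V(G)|}$ proper $L$-colourings of $G$.
   Context: Graphs are finite and simple; $N_G(v)$ is the set of neighbours of $v$. A $t$-list-assignment $L$ assigns each vertex $v$ a set $L(v)$ of exactly $t$ colours. An $L$-colouring is a function $\phi$ with $\phi(v)\in L(v)$ for all $v$; it is proper if adjacent vertices receive different colours. -}

module Defs where

open import Data.Nat using (ℕ; _+_; _*_; _^_; _≤_)
import Data.Nat.Properties as ℕP
open import Data.Bool using (Bool; true; false; if_then_else_)
open import Data.Fin using (Fin)
open import Data.List using (List; length; filter; map; allFin)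
open import Data.Nat.ListAction using (sum)
open import Data.List.Relation.Unary.Unique.Propositional using (Unique)
open import Data.List.Membership.DecPropositional ℕP._≟_ using (_∈_; _∈?_)
open import Data.Vec using (Vec; lookup)
open import Relation.Binary.PropositionalEquality using (_≡_; _≢_)

record Graph (n : ℕ) : Set where
  field
    adj     : Fin n → Fin n → Bool
    symm    : ∀ v w → adj v w ≡ adj w v
    irrefl  : ∀ v → adj v v ≡ false

open Graph public

record ListAssignment (n t : ℕ) : Set where
  field
    L        : Fin n → List ℕ
    distinct : ∀ v → Unique (L v)
    size     : ∀ v → length (L v) ≡ t

open ListAssignment public

-- |A ∩ B| for duplicate-free lists A, B
∣_∩_∣ : List ℕ → List ℕ → ℕ
∣ A ∩ B ∣ = length (filter (_∈? B) A)

nbrOverlap : ∀ {n t} → Graph n → ListAssignment n t → Fin n → ℕ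
nbrOverlap G La v =
  sum (map (λ w → if adj G v w then ∣ L La v ∩ L La w ∣ else 0) (allFin _))

IsLColouring : ∀ {n t} → ListAssignment n t → Vec ℕ n → Set
IsLColouring La φ = ∀ v → lookup φ v ∈ L La v

IsProper : ∀ {n} → Graph n → Vec ℕ n → Set
IsProper G φ = ∀ v w → adj G v w ≡ true → lookup φ v ≢ lookup φ w

IsProperLColouring : ∀ {n t} → Graph n → ListAssignment n t → Vec ℕ n → Set
IsProperLColouring G La φ = IsLColouring La φ × IsProper G φ
  where open import Data.Product using (_×_)

-- For S ⊆ V(G) let P(S) be the number of proper L-colourings of G[S]. Fix v ∈ S and pair
-- every colouring ψ of G[S - v] with a colour c ∈ L(v), giving t·P(S - v) pairs. A pair in
-- which no neighbour of v is coloured c extends to a colouring of G[S], injectively. A pair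
-- in which some neighbour w ∈ S - v has ψ(w) = c is recorded injectively as
-- (w, c, ψ restricted to S - v - w) with c ∈ L(v) ∩ L(w). By induction on |S|,
-- t·P(S - v - w) ≤ 2·P(S - v), so t·#clashing ≤ 2·P(S - v)·Σ_w |L(v) ∩ L(w)| ≤ P(S - v)·t²/2:
-- at most half of the pairs clash. Hence t·P(S - v) ≤ 2·P(S), and deleting the vertices one
-- at a time gives P(V) ≥ (t/2)^|V|.

module Submission where

open import Defs
open import Data.Nat using (ℕ; _+_; _*_; _^_; _≤_)
open import Data.Fin using (Fin)
open import Data.List using (List; length)
open import Data.List.Relation.Unary.All using (All)
open import Data.List.Relation.Unary.Unique.Propositional using (Unique)
open import Data.Vec using (Vec)
open import Data.Product using (Σ; _×_)

import Data.Nat.Properties as ℕ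
open import Data.Nat using (NonZero)
open import Data.Nat.Tactic.RingSolver using (solve)
open import Data.List using (_∷_; [])
open import Relation.Binary.PropositionalEquality

density-halving : ∀ t p b d .{{_ : NonZero t}} → t * b ≤ 2 * p * d → 4 * d ≤ t ^ 2 → 2 * b ≤ p * t
density-halving t p b d tb≤2pd 4d≤t² = ℕ.*-cancelʳ-≤ (2 * b) (p * t) (2 * t) {{ℕ.m*n≢0 2 t}} (begin
  2 * b * (2 * t)  ≡⟨ solve (t ∷ b ∷ []) ⟩
  4 * (t * b)      ≤⟨ ℕ.*-monoʳ-≤ 4 tb≤2pd ⟩
  4 * (2 * p * d)  ≡⟨ solve (p ∷ d ∷ []) ⟩
  2 * p * (4 * d)  ≤⟨ ℕ.*-monoʳ-≤ (2 * p) 4d≤t² ⟩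
  2 * p * t ^ 2    ≡⟨ cong (λ x → 2 * p * (t * x)) (ℕ.*-identityʳ t) ⟩
  2 * p * (t * t)  ≡⟨ solve (p ∷ t ∷ []) ⟩
  p * t * (2 * t)  ∎)
  where open ℕ.≤-Reasoning

split-≤-double : ∀ m b g q → m ≡ b + g → 2 * b ≤ m → g ≤ q → m ≤ 2 * q
split-≤-double m b g q m≡b+g 2b≤m g≤q = ℕ.+-cancelˡ-≤ m m (2 * q) (begin
  m + m            ≡⟨ solve (m ∷ []) ⟩
  2 * m            ≡⟨ cong (2 *_) m≡b+g ⟩
  2 * (b + g)      ≡⟨ ℕ.*-distribˡ-+ 2 b g ⟩
  2 * b + 2 * g    ≤⟨ ℕ.+-mono-≤ 2b≤m (ℕ.*-monoʳ-≤ 2 g≤q) ⟩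
  m + 2 * q        ∎)
  where open ℕ.≤-Reasoning

open import Data.Bool using (true; false; if_then_else_)
import Data.Bool.Properties as Bool
open import Data.Nat using (zero; suc; z≤n; s≤s; >-nonZero)
open import Data.Nat.ListAction using (sum)
open import Data.Fin using (zero; suc)
open import Data.Fin.Properties using (all?; any?) renaming (_≟_ to _≟ᶠ_)
open import Data.Fin.Subset using (Subset; ⊤; ⁅_⁆; _-_; ∣_∣; Nonempty; inside; outside)
  renaming (_∈_ to _∈ₛ_; _∉_ to _∉ₛ_)
open import Data.Fin.Subset.Properties
  using (p─⊥≡p; p─q⊆p; x∈p∧x≢y⇒x∈p-y; ∈⊤; ∣⊤∣≡n; ∣⊥∣≡0; Empty-unique; nonempty?)
  renaming (_∈?_ to _∈ₛ?_)
open import Data.List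
  using ([]; _∷_; filter; map; allFin; cartesianProduct; cartesianProductWith; concatMap)
open import Data.List.Properties using (length-++; length-map; length-removeAt′)
open import Data.List.Relation.Unary.All as All using ([])
open import Data.List.Relation.Unary.Unique.Propositional using ([]; _∷_)
open import Data.List.Relation.Unary.Any using (here; there; _─_)
import Data.List.Relation.Unary.Unique.Propositional.Properties as Unique
open import Data.List.Membership.Propositional using (_∈_)
open import Data.List.Membership.Propositional.Properties
  using (∈-cartesianProduct⁻; ∈-cartesianProductWith⁺; ∈-cartesianProductWith⁻;
         ∈-filter⁺; ∈-filter⁻; ∈-concat⁺′; ∈-map⁺; ∈-allFin; ∈-length)
open import Data.List.Membership.DecPropositional ℕ._≟_ using (_∈?_)
open import Data.Vec using ([]; _∷_; lookup; replicate; _[_]≔_; here; there)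
open import Data.Vec.Properties
  using (lookup∘update; lookup∘update′; []≔-idempotent; []≔-lookup; lookup-replicate; ∷-injective)
open import Data.Product as Product using (_,_; proj₁; proj₂; ∃)
open import Function using (_∘_)
open import Algebra.Properties.CommutativeSemigroup ℕ.*-commutativeSemigroup using (x∙yz≈y∙xz)
open import Relation.Nullary using (yes; no; ¬_; ¬?; does; contradiction)
open import Relation.Nullary.Decidable using (dec-true; dec-false; _×-dec_; _→-dec_)
open import Relation.Unary using (Pred; Decidable)
open import Relation.Unary.Properties using (∁?)

module _ {a} {A : Set a} where

  ∈-─⁺ : ∀ {x y} {ys : List A} (x∈ys : x ∈ ys) → y ∈ ys → y ≢ x → y ∈ (ys ─ x∈ys)
  ∈-─⁺ (here refl) (here refl) y≢x = contradiction refl y≢x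
  ∈-─⁺ (here refl) (there y∈ys) _   = y∈ys
  ∈-─⁺ (there _)   (here refl) _    = here refl
  ∈-─⁺ (there x∈ys) (there y∈ys) y≢x = there (∈-─⁺ x∈ys y∈ys y≢x)

  length-filter-∁ : ∀ {p} {P : Pred A p} (P? : Decidable P) xs →
                    length xs ≡ length (filter P? xs) + length (filter (∁? P?) xs)
  length-filter-∁ P? []       = refl
  length-filter-∁ P? (x ∷ xs) with does (P? x)
  ... | true  = cong suc (length-filter-∁ P? xs)
  ... | false = trans (cong suc (length-filter-∁ P? xs)) (sym (ℕ.+-suc _ _))

  *-distribˡ-sum-map : ∀ k (f : A → ℕ) xs → k * sum (map f xs) ≡ sum (map (λ x → k * f x) xs)
  *-distribˡ-sum-map k f []       = ℕ.*-zeroʳ k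
  *-distribˡ-sum-map k f (x ∷ xs) =
    trans (ℕ.*-distribˡ-+ k (f x) _) (cong (k * f x +_) (*-distribˡ-sum-map k f xs))

  sum-map-mono-≤ : ∀ {f g : A → ℕ} → (∀ x → f x ≤ g x) → ∀ xs → sum (map f xs) ≤ sum (map g xs)
  sum-map-mono-≤ f≤g []       = z≤n
  sum-map-mono-≤ f≤g (x ∷ xs) = ℕ.+-mono-≤ (f≤g x) (sum-map-mono-≤ f≤g xs)

module _ {a b} {A : Set a} {B : Set b} where

  length-≤-injection : ∀ {xs : List A} {ys : List B} (f : A → B) → Unique xs →
                       (∀ {x} → x ∈ xs → f x ∈ ys) →
                       (∀ {x y} → x ∈ xs → y ∈ xs → f x ≡ f y → x ≡ y) →
                       length xs ≤ length ys
  length-≤-injection {[]}     f _            _    _   = z≤n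
  length-≤-injection {x ∷ xs} {ys} f (x∉ ∷ xs!) into inj =
    subst (suc (length xs) ≤_) (sym (length-removeAt′ ys _))
      (s≤s (length-≤-injection f xs! into′ (λ x∈ y∈ → inj (there x∈) (there y∈))))
    where
    into′ : ∀ {y} → y ∈ xs → f y ∈ (ys ─ into (here refl))
    into′ y∈ = ∈-─⁺ (into (here refl)) (into (there y∈))
                 (λ fy≡fx → All.lookup x∉ y∈ (sym (inj (there y∈) (here refl) fy≡fx)))

  length-≤-leftInverse : ∀ {xs : List A} {ys : List B} (f : A → B) (g : B → A) → Unique xs →
                         (∀ {x} → x ∈ xs → f x ∈ ys) → (∀ {x} → x ∈ xs → g (f x) ≡ x) →
                         length xs ≤ length ys
  length-≤-leftInverse f g xs! into gf =
    length-≤-injection f xs! into (λ x∈ y∈ e → trans (sym (gf x∈)) (trans (cong g e) (gf y∈)))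

module _ {a b c} {A : Set a} {B : Set b} {C : Set c} where

  length-cartesianProductWith : ∀ (f : A → B → C) xs ys →
                                length (cartesianProductWith f xs ys) ≡ length xs * length ys
  length-cartesianProductWith f []       ys = refl
  length-cartesianProductWith f (x ∷ xs) ys =
    trans (length-++ (map (f x) ys))
          (cong₂ _+_ (length-map (f x) ys) (length-cartesianProductWith f xs ys))

module _ {a b} {A : Set a} {B : Set b} where

  length-concatMap : ∀ (f : A → List B) xs → length (concatMap f xs) ≡ sum (map (length ∘ f) xs)
  length-concatMap f []       = refl
  length-concatMap f (x ∷ xs) = trans (length-++ (f x)) (cong (length (f x) +_) (length-concatMap f xs))

module _ {a} {A : Set a} where

  choices : ∀ {m} → (Fin m → List A) → List (Vec A m)
  choices {zero}  B = [] ∷ []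
  choices {suc m} B = cartesianProductWith _∷_ (B zero) (choices (B ∘ suc))

  ∈-choices⁺ : ∀ {m} (B : Fin m → List A) {xs : Vec A m} → (∀ i → lookup xs i ∈ B i) → xs ∈ choices B
  ∈-choices⁺ {zero}  B {[]}     _  = here refl
  ∈-choices⁺ {suc m} B {x ∷ xs} xs∈B =
    ∈-cartesianProductWith⁺ _∷_ (xs∈B zero) (∈-choices⁺ (B ∘ suc) (xs∈B ∘ suc))

  ∈-choices⁻ : ∀ {m} (B : Fin m → List A) {xs : Vec A m} → xs ∈ choices B → ∀ i → lookup xs i ∈ B i
  ∈-choices⁻ {suc m} B xs∈ i with ∈-cartesianProductWith⁻ _∷_ (B zero) (choices (B ∘ suc)) xs∈
  ∈-choices⁻ {suc m} B _ zero    | _ , _ , x∈ , _ , refl = x∈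
  ∈-choices⁻ {suc m} B _ (suc i) | _ , _ , _ , ys∈ , refl = ∈-choices⁻ (B ∘ suc) ys∈ i

  choices-unique : ∀ {m} (B : Fin m → List A) → (∀ i → Unique (B i)) → Unique (choices B)
  choices-unique {zero}  B _  = [] ∷ []
  choices-unique {suc m} B B! =
    Unique.cartesianProductWith⁺ _∷_ ∷-injective (B! zero) (choices-unique (B ∘ suc) (B! ∘ suc))

  []≔-restore : ∀ {m} (xs : Vec A m) i {x y} → lookup xs i ≡ y → (xs [ i ]≔ x) [ i ]≔ y ≡ xs
  []≔-restore xs i refl = trans ([]≔-idempotent xs i) ([]≔-lookup xs i)

x∉p-x : ∀ {n} {p : Subset n} x → x ∉ₛ p - x
x∉p-x {p = inside  ∷ p} zero    ()
x∉p-x {p = outside ∷ p} zero    ()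
x∉p-x {p = s ∷ p}       (suc x) (there x∈) = x∉p-x x x∈

x∈p-y⇒x≢y : ∀ {n} {p : Subset n} {x y} → x ∈ₛ p - y → x ≢ y
x∈p-y⇒x≢y {x = x} x∈ refl = x∉p-x x x∈

p-x⊆p : ∀ {n} (p : Subset n) x {y} → y ∈ₛ p - x → y ∈ₛ p
p-x⊆p p x = p─q⊆p p ⁅ x ⁆

x∈p⇒∣p∣≡1+∣p-x∣ : ∀ {n} {p : Subset n} {x} → x ∈ₛ p → ∣ p ∣ ≡ suc ∣ p - x ∣
x∈p⇒∣p∣≡1+∣p-x∣ {p = inside  ∷ p} here        = cong (suc ∘ ∣_∣) (sym (p─⊥≡p p))
x∈p⇒∣p∣≡1+∣p-x∣ {p = inside  ∷ p} (there x∈p) = cong suc (x∈p⇒∣p∣≡1+∣p-x∣ x∈p)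
x∈p⇒∣p∣≡1+∣p-x∣ {p = outside ∷ p} (there x∈p) = x∈p⇒∣p∣≡1+∣p-x∣ x∈p

∣p∣≡0⇒x∉p : ∀ {n} {p : Subset n} {x} → ∣ p ∣ ≡ 0 → x ∉ₛ p
∣p∣≡0⇒x∉p |p|≡0 x∈p = contradiction (trans (sym |p|≡0) (x∈p⇒∣p∣≡1+∣p-x∣ x∈p)) λ ()

∣p∣≡1+k⇒Nonempty : ∀ {n} {p : Subset n} {k} → ∣ p ∣ ≡ suc k → Nonempty p
∣p∣≡1+k⇒Nonempty {n} {p} |p|≡1+k with nonempty? p
... | yes p≢∅ = p≢∅
... | no  p≡∅ = contradiction (trans (sym |p|≡1+k) (trans (cong ∣_∣ (Empty-unique p≡∅)) (∣⊥∣≡0 n))) λ ()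

x∈p∧∣p∣≡1+k⇒∣p-x∣≡k : ∀ {n} {p : Subset n} {x k} → x ∈ₛ p → ∣ p ∣ ≡ suc k → ∣ p - x ∣ ≡ k
x∈p∧∣p∣≡1+k⇒∣p-x∣≡k x∈p |p|≡1+k = ℕ.suc-injective (trans (sym (x∈p⇒∣p∣≡1+∣p-x∣ x∈p)) |p|≡1+k)


module Colourings {n t} (G : Graph n) (La : ListAssignment n t) where

  -- A colouring of G[S] is a vector over all of V(G) taking the dummy colour 0 outside S.
  palette : Subset n → Fin n → List ℕ
  palette S i = if does (i ∈ₛ? S) then L La i else 0 ∷ []

  palette-∈ : ∀ {S i} → i ∈ₛ S → palette S i ≡ L La i
  palette-∈ {S} {i} i∈S = cong (λ b → if b then L La i else 0 ∷ []) (dec-true (i ∈ₛ? S) i∈S)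

  palette-∉ : ∀ {S i} → i ∉ₛ S → palette S i ≡ 0 ∷ []
  palette-∉ {S} {i} i∉S = cong (λ b → if b then L La i else 0 ∷ []) (dec-false (i ∈ₛ? S) i∉S)

  palette-unique : ∀ S i → Unique (palette S i)
  palette-unique S i with does (i ∈ₛ? S)
  ... | true  = distinct La i
  ... | false = [] ∷ []

  palette-remove : ∀ S {v i} → i ≢ v → palette (S - v) i ≡ palette S i
  palette-remove S {v} i≢v with _ ∈ₛ? S
  ... | yes i∈S = trans (palette-∈ (x∈p∧x≢y⇒x∈p-y i∈S i≢v)) (sym (palette-∈ i∈S))
  ... | no  i∉S = trans (palette-∉ (i∉S ∘ p-x⊆p S v)) (sym (palette-∉ i∉S))

  ProperOn : Subset n → Vec ℕ n → Set
  ProperOn S φ = ∀ u w → u ∈ₛ S → w ∈ₛ S → adj G u w ≡ true → lookup φ u ≢ lookup φ w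

  proper? : ∀ S → Decidable (ProperOn S)
  proper? S φ = all? λ u → all? λ w →
    (u ∈ₛ? S) →-dec (w ∈ₛ? S) →-dec (adj G u w Bool.≟ true) →-dec ¬? (lookup φ u ℕ.≟ lookup φ w)

  colourings : Subset n → List (Vec ℕ n)
  colourings S = filter (proper? S) (choices (palette S))

  #colourings : Subset n → ℕ
  #colourings S = length (colourings S)

  colourings-unique : ∀ S → Unique (colourings S)
  colourings-unique S = Unique.filter⁺ (proper? S) (choices-unique (palette S) (palette-unique S))

  ∈-colourings⁺ : ∀ {S φ} → (∀ i → lookup φ i ∈ palette S i) → ProperOn S φ → φ ∈ colourings S
  ∈-colourings⁺ {S} φ∈palette proper = ∈-filter⁺ (proper? S) (∈-choices⁺ (palette S) φ∈palette) proper

  ∈-colourings⁻ : ∀ {S φ} → φ ∈ colourings S → (∀ i → lookup φ i ∈ palette S i) × ProperOn S φ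
  ∈-colourings⁻ {S} φ∈ = Product.map₁ (∈-choices⁻ (palette S)) (∈-filter⁻ (proper? S) φ∈)

  ∈-colourings-⊤⇒proper : ∀ {φ} → φ ∈ colourings ⊤ → IsProperLColouring G La φ
  ∈-colourings-⊤⇒proper φ∈ =
    (λ v → subst (_ ∈_) (palette-∈ ∈⊤) (proj₁ (∈-colourings⁻ φ∈) v)) ,
    (λ v w → proj₂ (∈-colourings⁻ φ∈) v w ∈⊤ ∈⊤)

  replicate-0-∈-colourings : ∀ {S} → (∀ i → i ∉ₛ S) → replicate n 0 ∈ colourings S
  replicate-0-∈-colourings S-empty = ∈-colourings⁺
    (λ i → subst₂ _∈_ (sym (lookup-replicate i 0)) (sym (palette-∉ (S-empty i))) (here refl))
    (λ u _ u∈S → contradiction u∈S (S-empty u))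

  colouring-outside≡0 : ∀ {S φ i} → φ ∈ colourings S → i ∉ₛ S → lookup φ i ≡ 0
  colouring-outside≡0 {i = i} φ∈ i∉S with subst (_ ∈_) (palette-∉ i∉S) (proj₁ (∈-colourings⁻ φ∈) i)
  ... | here φi≡0 = φi≡0

  restrict : ∀ {S φ} w → φ ∈ colourings S → φ [ w ]≔ 0 ∈ colourings (S - w)
  restrict {S} {φ} w φ∈ = ∈-colourings⁺ inPalette proper
    where
    inPalette : ∀ i → lookup (φ [ w ]≔ 0) i ∈ palette (S - w) i
    inPalette i with i ≟ᶠ w
    ... | yes refl = subst₂ _∈_ (sym (lookup∘update i φ 0)) (sym (palette-∉ (x∉p-x i))) (here refl)
    ... | no  i≢w  = subst₂ _∈_ (sym (lookup∘update′ i≢w φ 0)) (sym (palette-remove S i≢w))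
                       (proj₁ (∈-colourings⁻ φ∈) i)
    proper : ProperOn (S - w) (φ [ w ]≔ 0)
    proper u x u∈ x∈ ux = proj₂ (∈-colourings⁻ φ∈) u x (p-x⊆p S w u∈) (p-x⊆p S w x∈) ux ∘
      subst₂ _≡_ (lookup∘update′ (x∈p-y⇒x≢y u∈) φ 0) (lookup∘update′ (x∈p-y⇒x≢y x∈) φ 0)

  module Removal {S : Subset n} {v : Fin n} (v∈S : v ∈ₛ S) where

    ClashAt : Vec ℕ n × ℕ → Fin n → Set
    ClashAt (ψ , c) w = w ∈ₛ S - v × adj G v w ≡ true × lookup ψ w ≡ c

    Clash : Vec ℕ n × ℕ → Set
    Clash p = ∃ (ClashAt p)

    clash? : Decidable Clash
    clash? (ψ , c) = any? λ w → (w ∈ₛ? S - v) ×-dec (adj G v w Bool.≟ true) ×-dec (lookup ψ w ℕ.≟ c)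

    pairs clashing clashFree : List (Vec ℕ n × ℕ)
    pairs     = cartesianProduct (colourings (S - v)) (L La v)
    clashing  = filter clash? pairs
    clashFree = filter (∁? clash?) pairs

    pairs-unique : Unique pairs
    pairs-unique = Unique.cartesianProduct⁺ (colourings-unique (S - v)) (distinct La v)

    length-pairs : length pairs ≡ #colourings (S - v) * t
    length-pairs = trans (length-cartesianProductWith _,_ (colourings (S - v)) (L La v))
                         (cong (#colourings (S - v) *_) (size La v))

    extend : ∀ {ψ c} → ψ ∈ colourings (S - v) → c ∈ L La v → ¬ Clash (ψ , c) → ψ [ v ]≔ c ∈ colourings S
    extend {ψ} {c} ψ∈ c∈ noClash = ∈-colourings⁺ inPalette proper
      where
      inPalette : ∀ i → lookup (ψ [ v ]≔ c) i ∈ palette S i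
      inPalette i with i ≟ᶠ v
      ... | yes refl = subst₂ _∈_ (sym (lookup∘update i ψ c)) (sym (palette-∈ v∈S)) c∈
      ... | no  i≢v  = subst₂ _∈_ (sym (lookup∘update′ i≢v ψ c)) (palette-remove S i≢v)
                         (proj₁ (∈-colourings⁻ ψ∈) i)
      proper : ProperOn S (ψ [ v ]≔ c)
      proper u w u∈ w∈ uw ψ′u≡ψ′w with u ≟ᶠ v | w ≟ᶠ v
      ... | yes refl | yes refl = contradiction (trans (sym (irrefl G u)) uw) λ ()
      ... | yes refl | no  w≢v  = noClash (w , x∈p∧x≢y⇒x∈p-y w∈ w≢v , uw ,
              subst₂ _≡_ (lookup∘update′ w≢v ψ c) (lookup∘update u ψ c) (sym ψ′u≡ψ′w))
      ... | no  u≢v  | yes refl = noClash (u , x∈p∧x≢y⇒x∈p-y u∈ u≢v , trans (symm G w u) uw ,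
              subst₂ _≡_ (lookup∘update′ u≢v ψ c) (lookup∘update w ψ c) ψ′u≡ψ′w)
      ... | no  u≢v  | no  w≢v  =
            proj₂ (∈-colourings⁻ ψ∈) u w (x∈p∧x≢y⇒x∈p-y u∈ u≢v) (x∈p∧x≢y⇒x∈p-y w∈ w≢v) uw
              (subst₂ _≡_ (lookup∘update′ u≢v ψ c) (lookup∘update′ w≢v ψ c) ψ′u≡ψ′w)

    length-clashFree : length clashFree ≤ #colourings S
    length-clashFree =
      length-≤-leftInverse colourAt uncolourAt (Unique.filter⁺ (∁? clash?) pairs-unique) into restore
      where
      colourAt : Vec ℕ n × ℕ → Vec ℕ n
      colourAt (ψ , c) = ψ [ v ]≔ c
      uncolourAt : Vec ℕ n → Vec ℕ n × ℕ
      uncolourAt φ = φ [ v ]≔ 0 , lookup φ v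
      into : ∀ {p} → p ∈ clashFree → colourAt p ∈ colourings S
      into p∈ with p∈pairs , noClash ← ∈-filter⁻ (∁? clash?) p∈
              with ψ∈ , c∈ ← ∈-cartesianProduct⁻ _ _ p∈pairs = extend ψ∈ c∈ noClash
      restore : ∀ {p} → p ∈ clashFree → uncolourAt (colourAt p) ≡ p
      restore {ψ , c} p∈ with p∈pairs , _ ← ∈-filter⁻ (∁? clash?) p∈
                         with ψ∈ , _ ← ∈-cartesianProduct⁻ _ _ p∈pairs =
        cong₂ _,_ ([]≔-restore ψ v (colouring-outside≡0 ψ∈ (x∉p-x v))) (lookup∘update v ψ c)

    clashVertex : Vec ℕ n × ℕ → Fin n
    clashVertex p with clash? p
    ... | yes (w , _) = w
    ... | no  _       = v

    clashVertex-clashes : ∀ {p} → Clash p → ClashAt p (clashVertex p)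
    clashVertex-clashes {p} clash with clash? p
    ... | yes (_ , at) = at
    ... | no  noClash  = contradiction clash noClash

    sharedColours : Fin n → List ℕ
    sharedColours w = filter (_∈? L La w) (L La v)

    witnesses : Fin n → List (Fin n × ℕ × Vec ℕ n)
    witnesses w with adj G v w | w ∈ₛ? S - v
    ... | true  | yes _ =
      cartesianProductWith (λ c φ → w , c , φ) (sharedColours w) (colourings (S - v - w))
    ... | true  | no  _ = []
    ... | false | _     = []

    witness-∈ : ∀ {ψ c w} → ψ ∈ colourings (S - v) → c ∈ L La v → ClashAt (ψ , c) w →
                (w , c , ψ [ w ]≔ 0) ∈ witnesses w
    witness-∈ {ψ} {c} {w} ψ∈ c∈ (w∈ , vw , ψw≡c) with adj G v w | w ∈ₛ? S - v
    ... | true  | yes _  = ∈-cartesianProductWith⁺ (λ c φ → w , c , φ)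
                             (∈-filter⁺ (_∈? L La w) c∈ c∈Lw) (restrict w ψ∈)
      where c∈Lw = subst₂ _∈_ ψw≡c (palette-∈ w∈) (proj₁ (∈-colourings⁻ ψ∈) w)
    ... | true  | no w∉ = contradiction w∈ w∉
    witness-∈ _ _ (_ , () , _) | false | _

    length-clashing : length clashing ≤ length (concatMap witnesses (allFin n))
    length-clashing =
      length-≤-leftInverse witness unwitness (Unique.filter⁺ clash? pairs-unique) into restore
      where
      witness : Vec ℕ n × ℕ → Fin n × ℕ × Vec ℕ n
      witness (ψ , c) = clashVertex (ψ , c) , c , ψ [ clashVertex (ψ , c) ]≔ 0
      unwitness : Fin n × ℕ × Vec ℕ n → Vec ℕ n × ℕ
      unwitness (w , c , φ) = φ [ w ]≔ c , c
      into : ∀ {p} → p ∈ clashing → witness p ∈ concatMap witnesses (allFin n)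
      into p∈ with p∈pairs , clash ← ∈-filter⁻ clash? p∈
              with ψ∈ , c∈ ← ∈-cartesianProduct⁻ _ _ p∈pairs =
        ∈-concat⁺′ (witness-∈ ψ∈ c∈ (clashVertex-clashes clash)) (∈-map⁺ witnesses (∈-allFin _))
      restore : ∀ {p} → p ∈ clashing → unwitness (witness p) ≡ p
      restore {ψ , c} p∈ with _ , clash ← ∈-filter⁻ clash? {xs = pairs} p∈
                         with _ , _ , ψw≡c ← clashVertex-clashes {ψ , c} clash =
        cong (_, c) ([]≔-restore ψ (clashVertex (ψ , c)) ψw≡c)

    module _ (ih : ∀ {w} → w ∈ₛ S - v → t * #colourings (S - v - w) ≤ 2 * #colourings (S - v)) where

      length-witnesses : ∀ w → t * length (witnesses w) ≤
                         2 * #colourings (S - v) * (if adj G v w then ∣ L La v ∩ L La w ∣ else 0)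
      length-witnesses w with adj G v w | w ∈ₛ? S - v
      ... | true  | yes w∈ = begin
        t * length (cartesianProductWith _ (sharedColours w) (colourings (S - v - w)))
          ≡⟨ cong (t *_) (length-cartesianProductWith _ (sharedColours w) (colourings (S - v - w))) ⟩
        t * (k * #colourings (S - v - w))  ≡⟨ x∙yz≈y∙xz t k _ ⟩
        k * (t * #colourings (S - v - w))  ≤⟨ ℕ.*-monoʳ-≤ k (ih w∈) ⟩
        k * (2 * #colourings (S - v))      ≡⟨ ℕ.*-comm k _ ⟩
        2 * #colourings (S - v) * k        ∎
        where
        open ℕ.≤-Reasoning
        k = ∣ L La v ∩ L La w ∣
      ... | true  | no  _  = ℕ.≤-trans (ℕ.≤-reflexive (ℕ.*-zeroʳ t)) z≤n
      ... | false | _      = ℕ.≤-trans (ℕ.≤-reflexive (ℕ.*-zeroʳ t)) z≤n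

      length-allWitnesses :
        t * length (concatMap witnesses (allFin n)) ≤ 2 * #colourings (S - v) * nbrOverlap G La v
      length-allWitnesses = begin
        t * length (concatMap witnesses (allFin n))
          ≡⟨ cong (t *_) (length-concatMap witnesses (allFin n)) ⟩
        t * sum (map (length ∘ witnesses) (allFin n))
          ≡⟨ *-distribˡ-sum-map t _ (allFin n) ⟩
        sum (map (λ w → t * length (witnesses w)) (allFin n))
          ≤⟨ sum-map-mono-≤ length-witnesses (allFin n) ⟩
        sum (map (λ w → 2 * #colourings (S - v) * _) (allFin n))
          ≡⟨ *-distribˡ-sum-map (2 * #colourings (S - v)) _ (allFin n) ⟨
        2 * #colourings (S - v) * nbrOverlap G La v
          ∎
        where open ℕ.≤-Reasoning

      removal-step : .{{_ : NonZero t}} → 4 * nbrOverlap G La v ≤ t ^ 2 →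
                     t * #colourings (S - v) ≤ 2 * #colourings S
      removal-step sparse = subst (_≤ 2 * #colourings S) (ℕ.*-comm (#colourings (S - v)) t)
        (split-≤-double (#colourings (S - v) * t) (length clashing) (length clashFree) (#colourings S)
          (trans (sym length-pairs) (length-filter-∁ clash? pairs))
          (density-halving t (#colourings (S - v)) (length clashing) (nbrOverlap G La v)
            (ℕ.≤-trans (ℕ.*-monoʳ-≤ t length-clashing) length-allWitnesses) sparse)
          length-clashFree)

  module _ .{{_ : NonZero t}} (sparse : ∀ v → 4 * nbrOverlap G La v ≤ t ^ 2) where

    removal-bound : ∀ k {S v} → ∣ S ∣ ≡ k → v ∈ₛ S → t * #colourings (S - v) ≤ 2 * #colourings S
    removal-bound zero    |S|≡0   v∈S = contradiction v∈S (∣p∣≡0⇒x∉p |S|≡0)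
    removal-bound (suc k) |S|≡1+k v∈S =
      Removal.removal-step v∈S (removal-bound k (x∈p∧∣p∣≡1+k⇒∣p-x∣≡k v∈S |S|≡1+k)) (sparse _)

    colourings-lower-bound : ∀ k {S} → ∣ S ∣ ≡ k → t ^ k ≤ 2 ^ k * #colourings S
    colourings-lower-bound zero {S} |S|≡0 =
      ℕ.≤-trans (∈-length (replicate-0-∈-colourings (λ _ → ∣p∣≡0⇒x∉p |S|≡0))) (ℕ.m≤m+n (#colourings S) 0)
    colourings-lower-bound (suc k) {S} |S|≡1+k with v , v∈S ← ∣p∣≡1+k⇒Nonempty |S|≡1+k = begin
      t * t ^ k                        ≤⟨ ℕ.*-monoʳ-≤ t (colourings-lower-bound k |S-v|≡k) ⟩
      t * (2 ^ k * #colourings (S - v)) ≡⟨ x∙yz≈y∙xz t (2 ^ k) _ ⟩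
      2 ^ k * (t * #colourings (S - v)) ≤⟨ ℕ.*-monoʳ-≤ (2 ^ k) (removal-bound (suc k) |S|≡1+k v∈S) ⟩
      2 ^ k * (2 * #colourings S)       ≡⟨ x∙yz≈y∙xz (2 ^ k) 2 _ ⟩
      2 * (2 ^ k * #colourings S)       ≡⟨ ℕ.*-assoc 2 (2 ^ k) _ ⟨
      2 * 2 ^ k * #colourings S         ∎
      where
      open ℕ.≤-Reasoning
      |S-v|≡k = x∈p∧∣p∣≡1+k⇒∣p-x∣≡k v∈S |S|≡1+k

corollary13 : (t : ℕ) → 2 ≤ t → (n : ℕ) → (G : Graph n) → (La : ListAssignment n t)
    → (∀ v → 4 * nbrOverlap G La v ≤ t ^ 2)
    → Σ (List (Vec ℕ n)) (λ cs → Unique cs × All (IsProperLColouring G La) cs × t ^ n ≤ 2 ^ n * length cs)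
corollary13 t 2≤t n G La sparse =
  colourings ⊤ , colourings-unique ⊤ , All.tabulate ∈-colourings-⊤⇒proper ,
  colourings-lower-bound {{>-nonZero (ℕ.≤-trans (s≤s z≤n) 2≤t)}} sparse n (∣⊤∣≡n n)
  where open Colourings G La
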